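{- Let $b \in \mathbb{Z}\setminus\{ -1,0,1\}$ and let $A \subseteq \mathbb{N}\setminus\{0\}$ be nonempty. Let $\mathcal{L}_b(A)$ be the intersection of all $b$-LD-semigroups containing $A$. Then $\mathcal{L}_b(A)$ is the smallest $b$-LD-semigroup containing $A$ (in particular, it is a $b$-LD-semigroup).
   Context: Fix $b \in \mathbb{Z}\setminus\{ -1,0,1\}$ and let $N_b := \{0,1,\dots,|b|-1\}$. Put $Z_b := \mathbb{N}\setminus\{0\}$ if $b>0$ and $Z_b := \mathbb{Z}\setminus\{0\}$ if $b<0$ (here $\mathbb{N}=\{0,1,2,\dots\}$). Every $z \in Z_b$ has a unique representation $z=\sum_{i=0}^{n} u_i b^i$ with $u_0,\dots,u_n \in N_b$, $u_n \neq 0$; its length is $\ell_b(z) := n+1$, and $\ell_b(0):=1$. For $n \ge 1$ let $\Delta_b(n) := \{z \in Z_b : \ell_b(z)=n\}$. For $B \subseteq Z_b$ let $L_b(B) := \{\ell_b(a) : a \in B\}$. A $b$-digital semigroup is a (nonempty) subsemigroup $D$ of the multiplicative semigroup $(Z_b,\cdot)$ such that $\Delta_b(\ell_b(d)) \subseteq D$ for every $d \in D$. A submonoid $S$ of $(\mathbb{N},+)$ is called a $b$-LD-semigroup if there exists a $b$-digital semigroup $D$ with $S = L_b(D)\cup\{0\}$. -}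

module Defs where

open import Level using (Level; _⊔_; 0ℓ) renaming (suc to lsuc)
open import Data.Nat as ℕ using (ℕ; zero; suc)
open import Data.Integer as ℤ using (ℤ; +_; 0ℤ; ∣_∣)
open import Data.List using (List; []; _∷_; _++_; length)
open import Data.List.Relation.Unary.All using (All)
open import Data.Product using (Σ; ∃; _×_; _,_)
open import Data.Sum using (_⊎_)
open import Relation.Binary.PropositionalEquality using (_≡_; _≢_)
open import Function.Bundles using (_⇔_)

digitValue : ℤ → List ℕ → ℤ
digitValue b []       = 0ℤ
digitValue b (u ∷ us) = + u ℤ.+ b ℤ.* digitValue b us

InZ : ℤ → ℤ → Set
InZ b z = (0ℤ ℤ.< b → 0ℤ ℤ.< z) × (b ℤ.< 0ℤ → z ≢ 0ℤ)

-- z = Σ_{i=0}^{n} uᵢ bⁱ with all uᵢ ∈ N_b = {0,…,|b|-1} and uₙ ≠ 0;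
-- the digits are us ++ [d] with us = u₀ … u_{n-1} and d = uₙ.
Rep : ℤ → ℤ → ℕ → Set
Rep b z n = Σ (List ℕ) λ us → Σ ℕ λ d →
  length us ≡ n × All (λ u → u ℕ.< ∣ b ∣) us × 0 ℕ.< d × d ℕ.< ∣ b ∣ ×
  z ≡ digitValue b (us ++ d ∷ [])

-- ℓ_b(z) = m  (for z ∈ Z_b): the base-b representation has m = n+1 digits.
HasLen : ℤ → ℤ → ℕ → Set
HasLen b z m = Σ ℕ λ n → m ≡ suc n × Rep b z n

Δ : ℤ → ℕ → ℤ → Set
Δ b m z = InZ b z × HasLen b z m

record IsDigital {ℓ : Level} (b : ℤ) (D : ℤ → Set ℓ) : Set ℓ where
  field
    nonempty : Σ ℤ D
    sub      : ∀ z → D z → InZ b z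
    mulClosed : ∀ x y → D x → D y → D (x ℤ.* y)
    lenClosed : ∀ d m → D d → HasLen b d m → ∀ z → Δ b m z → D z

record IsSubmonoid {ℓ : Level} (S : ℕ → Set ℓ) : Set ℓ where
  field
    zero∈ : S 0
    +-closed : ∀ m n → S m → S n → S (m ℕ.+ n)

LbD∪0 : {ℓ : Level} → ℤ → (ℤ → Set ℓ) → ℕ → Set ℓ
LbD∪0 b D n = n ≡ 0 ⊎ Σ ℤ λ a → D a × HasLen b a n

IsLD : {ℓ : Level} → ℤ → (ℕ → Set ℓ) → Set (lsuc 0ℓ ⊔ ℓ)
IsLD b S = IsSubmonoid S ×
  Σ (ℤ → Set) λ D → IsDigital b D × (∀ n → S n ⇔ LbD∪0 b D n)

_⊆_ : {ℓ₁ ℓ₂ : Level} → (ℕ → Set ℓ₁) → (ℕ → Set ℓ₂) → Set (ℓ₁ ⊔ ℓ₂)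
P ⊆ Q = ∀ n → P n → Q n

𝓛 : ℤ → (ℕ → Set) → ℕ → Set₁
𝓛 b A n = (S : ℕ → Set) → IsLD b S → A ⊆ S → S n

{-# OPTIONS --safe #-}
module Submission where

-- The digital semigroup D of a b-LD-semigroup S ⊇ A contains Δ_b(a) for every a ∈ A and is
-- closed under products, under Δ_b(ℓ_b(d)) ⊆ D, and, because S is additively closed, under
-- Δ_b(m + n) ⊆ D whenever m and n are lengths of elements of D.  Hence D contains the digital
-- semigroup generated by these rules, and S contains its length set S₀.  As Δ_b(n) ∋ b^(n-1) is
-- nonempty for n ≥ 1, S₀ contains A and is itself a b-LD-semigroup, so 𝓛_b(A) = S₀.

open import Defs
open import Data.Nat using (ℕ)
open import Data.Integer using (ℤ; +_; -[1+_])
open import Data.Product using (Σ; _×_)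
open import Relation.Binary.PropositionalEquality using (_≢_)

open import Data.Nat as ℕ using (zero; suc; z≤n; s≤s)
import Data.Nat.Properties as ℕ
open import Data.Integer as ℤ using (0ℤ; ∣_∣)
import Data.Integer.Properties as ℤ
open import Data.List using ([]; _∷_; _++_; replicate)
open import Data.List.Properties using (length-replicate)
open import Data.List.Relation.Unary.All.Properties using (replicate⁺)
open import Data.Product using (_,_; proj₁; proj₂)
open import Data.Sum using (inj₁; inj₂; [_,_]′)
open import Data.Empty using (⊥-elim)
open import Function using (id)
open import Relation.Binary.PropositionalEquality using (_≡_; refl; sym; subst)
open import Function.Bundles using (_⇔_; mk⇔; Equivalence)
open import Function.Properties.Equivalence using () renaming (sym to ⇔-sym; trans to ⇔-trans)

b≢0,±1⇒1<∣b∣ : ∀ b → b ≢ -[1+ 0 ] → b ≢ + 0 → b ≢ + 1 → 1 ℕ.< ∣ b ∣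
b≢0,±1⇒1<∣b∣ (+ zero)          _    b≢0 _    = ⊥-elim (b≢0 refl)
b≢0,±1⇒1<∣b∣ (+ suc zero)      _    _   b≢1 = ⊥-elim (b≢1 refl)
b≢0,±1⇒1<∣b∣ (+ suc (suc n))   _    _   _   = s≤s (s≤s z≤n)
b≢0,±1⇒1<∣b∣ -[1+ zero ]       b≢-1 _   _   = ⊥-elim (b≢-1 refl)
b≢0,±1⇒1<∣b∣ -[1+ suc n ]      _    _   _   = s≤s (s≤s z≤n)

InZ-one : ∀ b → InZ b (+ 1)
InZ-one b = (λ _ → ℤ.+<+ (s≤s z≤n)) , (λ _ ())

InZ-base : ∀ b → InZ b b
InZ-base b = id , ℤ.<⇒≢

InZ-* : ∀ b x y → InZ b x → InZ b y → InZ b (x ℤ.* y)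
InZ-* b x y (x>0 , x≢0) (y>0 , y≢0) = positive , nonZero
  where
  positive : 0ℤ ℤ.< b → 0ℤ ℤ.< x ℤ.* y
  positive b>0 = subst (ℤ._< x ℤ.* y) (ℤ.*-zeroʳ x)
    (ℤ.*-monoˡ-<-pos x {{ℤ.positive (x>0 b>0)}} (y>0 b>0))
  nonZero : b ℤ.< 0ℤ → x ℤ.* y ≢ 0ℤ
  nonZero b<0 xy≡0 = [ x≢0 b<0 , y≢0 b<0 ]′ (ℤ.i*j≡0⇒i≡0∨j≡0 x xy≡0)

HasLen-suc : ∀ {b z m} → HasLen b z m → Σ ℕ λ n → m ≡ suc n
HasLen-suc (n , m≡1+n , _) = n , m≡1+n

power : ℤ → ℕ → ℤ
power b n = digitValue b (replicate n 0 ++ 1 ∷ [])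

power-zero : ∀ b → power b 0 ≡ + 1
power-zero b rewrite ℤ.*-zeroʳ b = refl

power-suc : ∀ b n → power b (suc n) ≡ b ℤ.* power b n
power-suc b n = ℤ.+-identityˡ (b ℤ.* power b n)

power-InZ : ∀ b n → InZ b (power b n)
power-InZ b zero    = subst (InZ b) (sym (power-zero b)) (InZ-one b)
power-InZ b (suc n) = subst (InZ b) (sym (power-suc b n))
  (InZ-* b b (power b n) (InZ-base b) (power-InZ b n))

Δ-inhabited : ∀ b → 1 ℕ.< ∣ b ∣ → ∀ n → Σ ℤ (Δ b (suc n))
Δ-inhabited b 1<∣b∣ n = power b n , power-InZ b n , n , refl , digits
  where
  digits : Rep b (power b n) n
  digits = replicate n 0 , 1 , length-replicate n
         , replicate⁺ n (ℕ.<-trans (s≤s z≤n) 1<∣b∣) , s≤s z≤n , 1<∣b∣ , refl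

IsLD-resp-⇔ : ∀ {ℓ₁ ℓ₂ b} {S : ℕ → Set ℓ₁} {T : ℕ → Set ℓ₂} →
              (∀ n → S n ⇔ T n) → IsLD b S → IsLD b T
IsLD-resp-⇔ {S = S} {T} S⇔T (S-monoid , D , D-digital , S⇔LD) =
  T-monoid , D , D-digital , λ n → ⇔-trans (⇔-sym (S⇔T n)) (S⇔LD n)
  where
  open IsSubmonoid S-monoid
  to : ∀ n → S n → T n
  to n = Equivalence.to (S⇔T n)
  from : ∀ n → T n → S n
  from n = Equivalence.from (S⇔T n)
  T-monoid : IsSubmonoid T
  T-monoid = record
    { zero∈    = to 0 zero∈
    ; +-closed = λ m n Tm Tn → to (m ℕ.+ n) (+-closed m n (from m Tm) (from n Tn))
    }

least-LD⇔𝓛 : ∀ b A (S₀ : ℕ → Set) → IsLD b S₀ → A ⊆ S₀ →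
             (∀ S → IsLD b S → A ⊆ S → S₀ ⊆ S) → ∀ n → S₀ n ⇔ 𝓛 b A n
least-LD⇔𝓛 b A S₀ S₀-LD A⊆S₀ S₀-least n =
  mk⇔ (λ S₀n S S-LD A⊆S → S₀-least S S-LD A⊆S n S₀n)
      (λ 𝓛n → 𝓛n S₀ S₀-LD A⊆S₀)

data Generated (b : ℤ) (A : ℕ → Set) : ℤ → Set where
  generator  : ∀ a z → A a → Δ b a z → Generated b A z
  product    : ∀ x y → Generated b A x → Generated b A y → Generated b A (x ℤ.* y)
  sameLength : ∀ d m → Generated b A d → HasLen b d m → ∀ z → Δ b m z → Generated b A z
  sumLength  : ∀ x y m n → Generated b A x → Generated b A y →
               HasLen b x m → HasLen b y n → ∀ z → Δ b (m ℕ.+ n) z → Generated b A z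

Generated-InZ : ∀ {b A} z → Generated b A z → InZ b z
Generated-InZ z (generator _ _ _ z∈Δ)               = proj₁ z∈Δ
Generated-InZ _ (product x y gx gy)                 = InZ-* _ x y (Generated-InZ x gx) (Generated-InZ y gy)
Generated-InZ z (sameLength _ _ _ _ _ z∈Δ)          = proj₁ z∈Δ
Generated-InZ z (sumLength _ _ _ _ _ _ _ _ _ z∈Δ)   = proj₁ z∈Δ

GeneratedLengths : ℤ → (ℕ → Set) → ℕ → Set
GeneratedLengths b A = LbD∪0 b (Generated b A)

module _ (b : ℤ) (1<∣b∣ : 1 ℕ.< ∣ b ∣) (A : ℕ → Set) (A∌0 : ∀ n → A n → n ≢ 0) where

  Δ-inhabited-on-A : ∀ a → A a → Σ ℤ (Δ b a)
  Δ-inhabited-on-A zero    a∈A = ⊥-elim (A∌0 0 a∈A refl)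
  Δ-inhabited-on-A (suc a) _   = Δ-inhabited b 1<∣b∣ a

  A⊆GeneratedLengths : A ⊆ GeneratedLengths b A
  A⊆GeneratedLengths a a∈A =
    let (z , z∈Δ) = Δ-inhabited-on-A a a∈A in inj₂ (z , generator a z a∈A z∈Δ , proj₂ z∈Δ)

  Generated-isDigital : Σ ℕ A → IsDigital b (Generated b A)
  Generated-isDigital (a , a∈A) = record
    { nonempty  = let (z , z∈Δ) = Δ-inhabited-on-A a a∈A in z , generator a z a∈A z∈Δ
    ; sub       = Generated-InZ
    ; mulClosed = product
    ; lenClosed = sameLength
    }

  GeneratedLengths-isSubmonoid : IsSubmonoid (GeneratedLengths b A)
  GeneratedLengths-isSubmonoid = record { zero∈ = inj₁ refl ; +-closed = +-closed }
    where
    +-closed : ∀ m n → GeneratedLengths b A m → GeneratedLengths b A n → GeneratedLengths b A (m ℕ.+ n)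
    +-closed _ n (inj₁ refl) n∈S = n∈S
    +-closed m _ (inj₂ m∈L) (inj₁ refl) rewrite ℕ.+-identityʳ m = inj₂ m∈L
    +-closed m n (inj₂ (x , gx , ℓx≡m)) (inj₂ (y , gy , ℓy≡n)) with HasLen-suc ℓx≡m
    ... | k , refl =
      let (z , z∈Δ) = Δ-inhabited b 1<∣b∣ (k ℕ.+ n)
      in inj₂ (z , sumLength x y m n gx gy ℓx≡m ℓy≡n z z∈Δ , proj₂ z∈Δ)

  GeneratedLengths-isLD : Σ ℕ A → IsLD b (GeneratedLengths b A)
  GeneratedLengths-isLD A-nonempty =
    GeneratedLengths-isSubmonoid , Generated b A , Generated-isDigital A-nonempty , λ _ → mk⇔ id id

module _ {b : ℤ} {A : ℕ → Set} (S : ℕ → Set) (S-LD : IsLD b S) (A⊆S : A ⊆ S) where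

  open IsSubmonoid (proj₁ S-LD)
  private
    D : ℤ → Set
    D = proj₁ (proj₂ S-LD)
    S⇔LD : ∀ n → S n ⇔ LbD∪0 b D n
    S⇔LD = proj₂ (proj₂ (proj₂ S-LD))
  open IsDigital (proj₁ (proj₂ (proj₂ S-LD)))

  length∈S : ∀ {x n} → D x → HasLen b x n → S n
  length∈S {x} {n} x∈D ℓx≡n = Equivalence.from (S⇔LD n) (inj₂ (x , x∈D , ℓx≡n))

  Δ⊆D : ∀ {m} z → S m → Δ b m z → D z
  Δ⊆D {m} z m∈S z∈Δ with Equivalence.to (S⇔LD m) m∈S | HasLen-suc (proj₂ z∈Δ)
  ... | inj₁ refl              | _ , ()
  ... | inj₂ (d , d∈D , ℓd≡m) | _ = lenClosed d m d∈D ℓd≡m z z∈Δ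

  Generated⊆D : ∀ z → Generated b A z → D z
  Generated⊆D z (generator a _ a∈A z∈Δ) = Δ⊆D z (A⊆S a a∈A) z∈Δ
  Generated⊆D _ (product x y gx gy) = mulClosed x y (Generated⊆D x gx) (Generated⊆D y gy)
  Generated⊆D z (sameLength d m gd ℓd≡m _ z∈Δ) = lenClosed d m (Generated⊆D d gd) ℓd≡m z z∈Δ
  Generated⊆D z (sumLength x y m n gx gy ℓx≡m ℓy≡n _ z∈Δ) =
    Δ⊆D z (+-closed m n (length∈S (Generated⊆D x gx) ℓx≡m) (length∈S (Generated⊆D y gy) ℓy≡n)) z∈Δ

  GeneratedLengths⊆ : GeneratedLengths b A ⊆ S
  GeneratedLengths⊆ _ (inj₁ refl)           = zero∈
  GeneratedLengths⊆ _ (inj₂ (x , gx , ℓx)) = length∈S (Generated⊆D x gx) ℓx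

proposition3p2 : (b : ℤ) → b ≢ -[1+ 0 ] → b ≢ + 0 → b ≢ + 1 →
    (A : ℕ → Set) → (∀ n → A n → n ≢ 0) → Σ ℕ A →
    IsLD b (𝓛 b A) × A ⊆ 𝓛 b A ×
    ((S : ℕ → Set) → IsLD b S → A ⊆ S → 𝓛 b A ⊆ S)
proposition3p2 b b≢-1 b≢0 b≢1 A A∌0 A-nonempty =
  IsLD-resp-⇔ S₀⇔𝓛 S₀-LD ,
  (λ n n∈A S _ A⊆S → A⊆S n n∈A) ,
  (λ S S-LD A⊆S n n∈𝓛 → n∈𝓛 S S-LD A⊆S)
  where
  1<∣b∣ : 1 ℕ.< ∣ b ∣
  1<∣b∣ = b≢0,±1⇒1<∣b∣ b b≢-1 b≢0 b≢1
  S₀-LD : IsLD b (GeneratedLengths b A)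
  S₀-LD = GeneratedLengths-isLD b 1<∣b∣ A A∌0 A-nonempty
  S₀⇔𝓛 : ∀ n → GeneratedLengths b A n ⇔ 𝓛 b A n
  S₀⇔𝓛 = least-LD⇔𝓛 b A (GeneratedLengths b A) S₀-LD
           (A⊆GeneratedLengths b 1<∣b∣ A A∌0) GeneratedLengths⊆
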